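{- Let $\mathcal{L}$ be a 5c-labeling of a 5-triangulation $G$. For every inner edge $e$ of $G$, the sum of the label jumps between consecutive corners, taken in counterclockwise order around $e$, equals 5.
   Context: A 5-triangulation is a plane map (connected planar graph with fixed embedding) whose inner faces have degree 3 and whose outer face contour is a simple 5-cycle with vertices $v_1,\dots,v_5$ in clockwise order. A corner is a sector between two consecutive edges around a vertex; corners, edges incident to the outer face are outer, others inner. Indices in $[1:5]$ are modulo 5. For an inner edge $e=\{u,v\}$, the corners around $e$ are the four corners incident to $e$ (the two corners at $u$ on either side of $e$ and the two at $v$), taken in the cyclic order in which a small loop around $e$ traversed counterclockwise meets them. A corner labeling assigns a label in $[1:5]$ to each inner corner; the label jump from label $i$ to label $i'$ is the $\delta\in\{0,\dots,4\}$ with $i+\delta\equiv i'\pmod 5$. A 5c-labeling is a corner labeling with: (L0) every inner corner at $v_i$ has label $i$; (L1) around each inner vertex the corners form 5 nonempty clockwise-consecutive intervals $I_1,\dots,I_5$ with labels $1,\dots,5$ respectively; (L2) around each inner face, in clockwise order, there are two label jumps equal to 2 and one equal to 1. -}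

module Defs where

open import Data.Nat using (ℕ; zero; suc; _+_; _∸_; _≤_; _<_; _≤?_)
open import Data.Nat.DivMod using (_%_)
open import Data.Fin using (Fin; toℕ) renaming (zero to 0F; suc to fsuc)
open import Data.Fin.Properties using (all?)
open import Data.List using (List; length; filter; allFin)
open import Data.Product using (Σ; ∃; _×_; _,_)
open import Data.Sum using (_⊎_)
open import Relation.Binary.PropositionalEquality using (_≡_; _≢_)
open import Relation.Binary.Construct.Closure.ReflexiveTransitive using (Star)
open import Relation.Nullary using (¬_)

iter : {A : Set} → (A → A) → ℕ → A → A
iter f zero    x = x
iter f (suc k) x = f (iter f k x)

SameOrbit : {A : Set} → (A → A) → A → A → Set
SameOrbit p x y = ∃ λ k → iter p k x ≡ y

-- number of orbits of a permutation p of Fin n: the number of elements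
-- x that are the least element (w.r.t. toℕ) of their orbit
-- {p^k x | k < n}
numOrbits : {n : ℕ} → (Fin n → Fin n) → ℕ
numOrbits {n} p =
  length (filter (λ x → all? (λ (k : Fin n) → toℕ x ≤? toℕ (iter p (toℕ k) x)))
                 (allFin n))

-- Darts (half-edges) are Fin n.  α x is the opposite dart of x (same
-- edge), σ x is the next dart clockwise around the origin vertex of x.
-- The corner "x" is the sector at the origin of x between x and σ x
-- (going clockwise from x); corners are in bijection with darts.
-- The face containing corner x is the face to the right of x; the
-- next corner clockwise around that face is  faceCW x = σ⁻ (α x).

record Map : Set where
  field
    n     : ℕ
    α     : Fin n → Fin n
    σ     : Fin n → Fin n
    σ⁻    : Fin n → Fin n
    α-invol : ∀ x → α (α x) ≡ x
    α-nofix : ∀ x → α x ≢ x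
    σσ⁻   : ∀ x → σ (σ⁻ x) ≡ x
    σ⁻σ   : ∀ x → σ⁻ (σ x) ≡ x

  Dart : Set
  Dart = Fin n

  faceCW : Dart → Dart
  faceCW x = σ⁻ (α x)

  Adj : Dart → Dart → Set
  Adj x y = (y ≡ α x) ⊎ (y ≡ σ x)

  Connected : Set
  Connected = ∀ x y → Star Adj x y

  #V #E #F : ℕ
  #V = numOrbits σ
  #E = numOrbits α
  #F = numOrbits faceCW

  -- genus 0 (Euler's formula  V - E + F = 2)
  Planar : Set
  Planar = #V + #F ≡ #E + 2

-- Indices in [1:5] are represented by Fin 5 (label i ↔ Fin index i-1).

next5 : Fin 5 → Fin 5
next5 0F = fsuc 0F
next5 (fsuc 0F) = fsuc (fsuc 0F)
next5 (fsuc (fsuc 0F)) = fsuc (fsuc (fsuc 0F))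
next5 (fsuc (fsuc (fsuc 0F))) = fsuc (fsuc (fsuc (fsuc 0F)))
next5 (fsuc (fsuc (fsuc (fsuc 0F)))) = 0F

-- 5-triangulation: a plane map (connected, genus 0, with a distinguished
-- outer face) whose outer face contour is a simple 5-cycle v₁…v₅ in
-- clockwise order and whose inner faces all have degree 3.
-- out i is the dart from v_i to v_{i+1} (along the outer contour).
-- The outer face is the face to the right of α (out i), i.e. its
-- corners are the α (out i).

record FiveTriangulation : Set where
  field
    M : Map
  open Map M public
  field
    connected : Connected
    planar    : Planar
    out       : Fin 5 → Dart
    -- the outer face is a face: at v_{i+1}, going clockwise from the
    -- edge towards v_i through the outer face one reaches the edge
    -- towards v_{i+2}
    out-face  : ∀ i → out (next5 i) ≡ σ (α (out i))
    out-simple : ∀ i j → SameOrbit σ (out i) (out j) → i ≡ j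

  OuterCorner : Dart → Set
  OuterCorner x = ∃ λ i → x ≡ α (out i)

  InnerCorner : Dart → Set
  InnerCorner x = ¬ OuterCorner x

  InnerEdge : Dart → Set
  InnerEdge x = ∀ i → (x ≢ out i) × (x ≢ α (out i))

  AtOuterVertex : Fin 5 → Dart → Set
  AtOuterVertex i x = SameOrbit σ (out i) x

  InnerVertexDart : Dart → Set
  InnerVertexDart x = ∀ i → ¬ AtOuterVertex i x

  field
    triangular : ∀ x → InnerCorner x →
                 (iter faceCW 3 x ≡ x) × (faceCW x ≢ x)

-- label jump from label a to label b: the δ ∈ {0,…,4} with a + δ ≡ b (mod 5)
jump : Fin 5 → Fin 5 → ℕ
jump a b = (toℕ b + 5 ∸ toℕ a) % 5

l1 l2 l3 l4 l5 : Fin 5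
l1 = 0F
l2 = fsuc 0F
l3 = fsuc (fsuc 0F)
l4 = fsuc (fsuc (fsuc 0F))
l5 = fsuc (fsuc (fsuc (fsuc 0F)))

TwoTwoOne : ℕ → ℕ → ℕ → Set
TwoTwoOne a b c = (a ≡ 2 × b ≡ 2 × c ≡ 1)
                ⊎ (a ≡ 2 × b ≡ 1 × c ≡ 2)
                ⊎ (a ≡ 1 × b ≡ 2 × c ≡ 2)

module _ (G : FiveTriangulation) where
  open FiveTriangulation G

  -- A corner labeling: a label for each corner (only the labels of
  -- inner corners are ever used).
  CornerLabeling : Set
  CornerLabeling = Dart → Fin 5

  -- (L1) at the vertex of dart s: starting at some corner t of that
  -- vertex, the corners t, σ t, …, σ^(m-1) t (clockwise, m = degree)
  -- split into 5 nonempty consecutive intervals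
  -- [0,b₁), [b₁,b₂), [b₂,b₃), [b₃,b₄), [b₄,m) with labels 1,…,5.
  FiveIntervals : CornerLabeling → Dart → Set
  FiveIntervals ℓ s =
    Σ Dart λ t → SameOrbit σ s t ×
    Σ ℕ λ b₁ → Σ ℕ λ b₂ → Σ ℕ λ b₃ → Σ ℕ λ b₄ → Σ ℕ λ m →
      (0 < b₁) × (b₁ < b₂) × (b₂ < b₃) × (b₃ < b₄) × (b₄ < m) ×
      (iter σ m t ≡ t) × (∀ j → 0 < j → j < m → iter σ j t ≢ t) ×
      (∀ j → j < b₁ → ℓ (iter σ j t) ≡ l1) ×
      (∀ j → b₁ ≤ j → j < b₂ → ℓ (iter σ j t) ≡ l2) ×
      (∀ j → b₂ ≤ j → j < b₃ → ℓ (iter σ j t) ≡ l3) ×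
      (∀ j → b₃ ≤ j → j < b₄ → ℓ (iter σ j t) ≡ l4) ×
      (∀ j → b₄ ≤ j → j < m  → ℓ (iter σ j t) ≡ l5)

  record Is5cLabeling (ℓ : CornerLabeling) : Set where
    field
      L0 : ∀ i x → AtOuterVertex i x → InnerCorner x → ℓ x ≡ i
      L1 : ∀ s → InnerVertexDart s → FiveIntervals ℓ s
      L2 : ∀ x → InnerCorner x →
           TwoTwoOne (jump (ℓ x) (ℓ (faceCW x)))
                     (jump (ℓ (faceCW x)) (ℓ (faceCW (faceCW x))))
                     (jump (ℓ (faceCW (faceCW x))) (ℓ x))

  -- The four corners around the inner edge of dart x (from u to v), in
  -- counterclockwise order: x (at u, right of x), σ⁻ (α x) (at v, right
  -- of x), α x (at v, left of x), σ⁻ x (at u, left of x).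
  edgeJumpSum : CornerLabeling → Dart → ℕ
  edgeJumpSum ℓ x =
      jump (ℓ x) (ℓ (σ⁻ (α x)))
    + jump (ℓ (σ⁻ (α x))) (ℓ (α x))
    + jump (ℓ (α x)) (ℓ (σ⁻ x))
    + jump (ℓ (σ⁻ x)) (ℓ x)

-- Around an inner edge the four corners alternate between the two incident
-- vertices and the two incident faces.  A step between two corners of the
-- same face is a face jump, hence 1 or 2 by (L2); a step between two
-- corners of the same vertex is 0 at an outer vertex by (L0) and 0 or 1 at
-- an inner vertex, since by (L1) consecutive corners there carry equal or
-- consecutive labels.  The four jumps close a cycle of labels, so their sum
-- is a multiple of 5 lying between 2 and 6, i.e. it is 5.
module Submission where

open import Defs
open import Data.Fin using (Fin) renaming (zero to 0F; suc to fsuc)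
open import Data.Fin.Properties using (all?)
open import Data.Nat using (ℕ; zero; suc; _+_; _*_; _≤_; _<_; _<?_; _≟_; z≤n)
open import Data.Nat.DivMod using (_%_; _/_; m≡m%n+[m/n]*n; m%n<n)
open import Data.Nat.Properties
  using (≮⇒≥; ≤-<-trans; ≤-antisym; m≤n⇒m≤1+n; m<1+n⇒m≤n; n<1+n; *-comm)
open import Data.Product using (∃; _×_; _,_; proj₁; proj₂)
open import Data.Sum using (_⊎_; inj₁; inj₂)
open import Effect.Monad using (RawMonad)
open import Level using (0ℓ)
open import Relation.Binary.PropositionalEquality
  using (_≡_; refl; sym; trans; cong; subst; subst₂; module ≡-Reasoning)
open import Relation.Nullary using (¬_; Dec; yes; no)
open import Relation.Nullary.Decidable using (decidable-stable; _→-dec_; _⊎-dec_; toWitness)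
open import Relation.Nullary.Decidable.Core using (¬¬-excluded-middle)
open import Relation.Nullary.Negation using (¬¬-map; ¬¬-Monad)

Is0or1 Is1or2 : ℕ → Set
Is0or1 n = n ≡ 0 ⊎ n ≡ 1
Is1or2 n = n ≡ 1 ⊎ n ≡ 2

jump-refl : ∀ p → jump p p ≡ 0
jump-refl 0F                             = refl
jump-refl (fsuc 0F)                      = refl
jump-refl (fsuc (fsuc 0F))               = refl
jump-refl (fsuc (fsuc (fsuc 0F)))        = refl
jump-refl (fsuc (fsuc (fsuc (fsuc 0F)))) = refl

jump-next5 : ∀ p → jump p (next5 p) ≡ 1
jump-next5 0F                             = refl
jump-next5 (fsuc 0F)                      = refl
jump-next5 (fsuc (fsuc 0F))               = refl
jump-next5 (fsuc (fsuc (fsuc 0F)))        = refl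
jump-next5 (fsuc (fsuc (fsuc (fsuc 0F)))) = refl

TwoTwoOne⇒first-Is1or2 : ∀ {a b c} → TwoTwoOne a b c → Is1or2 a
TwoTwoOne⇒first-Is1or2 (inj₁ (a≡2 , _))        = inj₂ a≡2
TwoTwoOne⇒first-Is1or2 (inj₂ (inj₁ (a≡2 , _))) = inj₂ a≡2
TwoTwoOne⇒first-Is1or2 (inj₂ (inj₂ (a≡1 , _))) = inj₁ a≡1

JumpCycleSum≡5 : Fin 5 → Fin 5 → Fin 5 → Fin 5 → Set
JumpCycleSum≡5 a b c d =
  Is1or2 (jump a b) → Is0or1 (jump b c) → Is1or2 (jump c d) → Is0or1 (jump d a) →
  jump a b + jump b c + jump c d + jump d a ≡ 5

jumpCycleSum≡5? : ∀ a b c d → Dec (JumpCycleSum≡5 a b c d)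
jumpCycleSum≡5? a b c d =
  is1or2? (jump a b) →-dec (is0or1? (jump b c) →-dec
  (is1or2? (jump c d) →-dec (is0or1? (jump d a) →-dec
  (jump a b + jump b c + jump c d + jump d a ≟ 5))))
  where
  is0or1? : ∀ n → Dec (Is0or1 n)
  is0or1? n = n ≟ 0 ⊎-dec n ≟ 1
  is1or2? : ∀ n → Dec (Is1or2 n)
  is1or2? n = n ≟ 1 ⊎-dec n ≟ 2

jumpCycleSum≡5 : ∀ a b c d → JumpCycleSum≡5 a b c d
jumpCycleSum≡5 = toWitness {a? = all? λ a → all? λ b → all? λ c → all? λ d → jumpCycleSum≡5? a b c d} _

intervals-join : ∀ {P : ℕ → Set} {a b c} →
                 (∀ j → a ≤ j → j < b → P j) → (∀ j → b ≤ j → j < c → P j) →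
                 ∀ j → a ≤ j → j < c → P j
intervals-join {b = b} left right j a≤j j<c with j <? b
... | yes j<b = left j a≤j j<b
... | no  j≮b = right j (≮⇒≥ j≮b) j<c

module LabelSteps (g : ℕ → Fin 5) where

  Step : ℕ → Set
  Step j = Is0or1 (jump (g j) (g (suc j)))

  constant-then-next⇒steps :
    ∀ {a b c p} → (∀ j → a ≤ j → j < b → g j ≡ p) →
    (∀ j → b ≤ j → j < c → g j ≡ next5 p) → b < c →
    ∀ j → a ≤ j → j < b → Step j
  constant-then-next⇒steps {b = b} {p = p} here next b<c j a≤j j<b
    rewrite here j a≤j j<b with suc j <? b
  ... | yes 1+j<b rewrite here (suc j) (m≤n⇒m≤1+n a≤j) 1+j<b = inj₁ (jump-refl p)
  ... | no  1+j≮b rewrite next (suc j) (≮⇒≥ 1+j≮b) (≤-<-trans j<b b<c) = inj₂ (jump-next5 p)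

  fiveIntervals⇒steps :
    ∀ {b₁ b₂ b₃ b₄ m} → b₁ < b₂ → b₂ < b₃ → b₃ < b₄ → b₄ < m → g m ≡ l1 →
    (∀ j → j < b₁ → g j ≡ l1) →
    (∀ j → b₁ ≤ j → j < b₂ → g j ≡ l2) →
    (∀ j → b₂ ≤ j → j < b₃ → g j ≡ l3) →
    (∀ j → b₃ ≤ j → j < b₄ → g j ≡ l4) →
    (∀ j → b₄ ≤ j → j < m  → g j ≡ l5) →
    ∀ j → j < m → Step j
  fiveIntervals⇒steps {m = m} b₁<b₂ b₂<b₃ b₃<b₄ b₄<m gm≡l1 i₁ i₂ i₃ i₄ i₅ j j<m =
    intervals-join (intervals-join (intervals-join (intervals-join
      (constant-then-next⇒steps (λ j _ → i₁ j) i₂ b₁<b₂)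
      (constant-then-next⇒steps i₂ i₃ b₂<b₃))
      (constant-then-next⇒steps i₃ i₄ b₃<b₄))
      (constant-then-next⇒steps i₄ i₅ b₄<m))
      (constant-then-next⇒steps i₅ wrapAround (n<1+n m))
      j z≤n j<m
    where
    wrapAround : ∀ j → m ≤ j → j < suc m → g j ≡ l1
    wrapAround j m≤j j<1+m = subst (λ k → g k ≡ l1) (≤-antisym m≤j (m<1+n⇒m≤n j<1+m)) gm≡l1

module _ {A : Set} (f : A → A) where

  iter-+ : ∀ m n x → iter f (m + n) x ≡ iter f m (iter f n x)
  iter-+ zero    n x = refl
  iter-+ (suc m) n x = cong f (iter-+ m n x)

  iter-periodic : ∀ {m x} → iter f m x ≡ x → ∀ q → iter f (q * m) x ≡ x
  iter-periodic         fᵐx≡x zero    = refl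
  iter-periodic {m} {x} fᵐx≡x (suc q) = begin
    iter f (m + q * m) x      ≡⟨ iter-+ m (q * m) x ⟩
    iter f m (iter f (q * m) x) ≡⟨ cong (iter f m) (iter-periodic fᵐx≡x q) ⟩
    iter f m x                ≡⟨ fᵐx≡x ⟩
    x                         ∎
    where open ≡-Reasoning

  iter-% : ∀ {m x} → iter f (suc m) x ≡ x → ∀ n → iter f n x ≡ iter f (n % suc m) x
  iter-% {m} {x} period n = begin
    iter f n x                         ≡⟨ cong (λ k → iter f k x) (m≡m%n+[m/n]*n n (suc m)) ⟩
    iter f (r + q * suc m) x           ≡⟨ iter-+ r (q * suc m) x ⟩
    iter f r (iter f (q * suc m) x)    ≡⟨ cong (iter f r) (iter-periodic period q) ⟩
    iter f r x                         ∎
    where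
    open ≡-Reasoning
    r q : ℕ
    r = n % suc m
    q = n / suc m

  module _ {g : A → A} (g∘f≡id : ∀ x → g (f x) ≡ x) where

    iter-injective : ∀ k {x y} → iter f k x ≡ iter f k y → x ≡ y
    iter-injective zero    eq = eq
    iter-injective (suc k) {x} {y} eq = iter-injective k (begin
      iter f k x         ≡⟨ g∘f≡id _ ⟨
      g (iter f (suc k) x) ≡⟨ cong g eq ⟩
      g (iter f (suc k) y) ≡⟨ g∘f≡id _ ⟩
      iter f k y         ∎)
      where open ≡-Reasoning

    -- s = f^(m·k) t, because applying f^k to the right-hand side gives f^((m+1)·k) t = t.
    cycle-reaches : ∀ {m k s t} → iter f (suc m) t ≡ t → iter f k s ≡ t →
                    ∃ λ j → j < suc m × s ≡ iter f j t
    cycle-reaches {m} {k} {s} {t} period fᵏs≡t =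
      m * k % suc m , m%n<n (m * k) (suc m) , trans s≡ (iter-% period (m * k))
      where
      open ≡-Reasoning
      s≡ : s ≡ iter f (m * k) t
      s≡ = iter-injective k (begin
        iter f k s                   ≡⟨ fᵏs≡t ⟩
        t                            ≡⟨ iter-periodic period k ⟨
        iter f (k * suc m) t         ≡⟨ cong (λ n → iter f n t) (*-comm k (suc m)) ⟩
        iter f (k + m * k) t         ≡⟨ iter-+ k (m * k) t ⟩
        iter f k (iter f (m * k) t)  ∎)

module InnerEdges (G : FiveTriangulation) where
  open FiveTriangulation G

  α-injective : ∀ {x y} → α x ≡ α y → x ≡ y
  α-injective {x} {y} eq = trans (sym (α-invol x)) (trans (cong α eq) (α-invol y))

  innerEdge-α : ∀ {x} → InnerEdge x → InnerEdge (α x)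
  innerEdge-α {x} inner i =
      (λ αx≡outᵢ → proj₂ (inner i) (trans (sym (α-invol x)) (cong α αx≡outᵢ)))
    , (λ αx≡αoutᵢ → proj₁ (inner i) (α-injective αx≡αoutᵢ))

  innerEdge⇒innerCorner : ∀ {x} → InnerEdge x → InnerCorner x
  innerEdge⇒innerCorner inner (i , x≡αoutᵢ) = proj₂ (inner i) x≡αoutᵢ

  innerEdge⇒innerCorner-σ⁻ : ∀ {x} → InnerEdge x → InnerCorner (σ⁻ x)
  innerEdge⇒innerCorner-σ⁻ {x} inner (i , σ⁻x≡αoutᵢ) =
    proj₁ (inner (next5 i)) (trans (sym (σσ⁻ x)) (trans (cong σ σ⁻x≡αoutᵢ) (sym (out-face i))))

  faceCW-α : ∀ x → faceCW (α x) ≡ σ⁻ x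
  faceCW-α x = cong σ⁻ (α-invol x)

module LabeledTriangulation (G : FiveTriangulation) (ℓ : CornerLabeling G) (L : Is5cLabeling G ℓ) where
  open FiveTriangulation G
  open Is5cLabeling L
  open InnerEdges G

  faceStep : ∀ x → InnerCorner x → Is1or2 (jump (ℓ x) (ℓ (faceCW x)))
  faceStep x inner = TwoTwoOne⇒first-Is1or2 (L2 x inner)

  innerVertexStep : ∀ y → InnerVertexDart (σ⁻ y) → Is0or1 (jump (ℓ (σ⁻ y)) (ℓ y))
  innerVertexStep y inner with L1 (σ⁻ y) inner
  ... | t , (k , σᵏs≡t) , b₁ , b₂ , b₃ , b₄ , suc m ,
        0<b₁ , b₁<b₂ , b₂<b₃ , b₃<b₄ , b₄<m , period , _ , i₁ , i₂ , i₃ , i₄ , i₅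
    with cycle-reaches σ {g = σ⁻} σ⁻σ {k = k} period σᵏs≡t
  ... | j , j<m , s≡σʲt =
    subst₂ (λ u v → Is0or1 (jump (ℓ u) (ℓ v))) (sym s≡σʲt) σʲ⁺¹t≡y
      (fiveIntervals⇒steps b₁<b₂ b₂<b₃ b₃<b₄ b₄<m ℓσᵐt≡l1 i₁ i₂ i₃ i₄ i₅ j j<m)
    where
    open LabelSteps (λ j → ℓ (iter σ j t))
    ℓσᵐt≡l1 : ℓ (iter σ (suc m) t) ≡ l1
    ℓσᵐt≡l1 = trans (cong ℓ period) (i₁ 0 0<b₁)
    σʲ⁺¹t≡y : iter σ (suc j) t ≡ y
    σʲ⁺¹t≡y = trans (cong σ (sym s≡σʲt)) (σσ⁻ y)

  -- Being at an outer vertex (an unbounded ∃ over orbit lengths) is not decidable,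
  -- so the case split is made under ¬ ¬; the final goal, an equation in ℕ, is stable.
  vertexStep : ∀ y → InnerCorner y → InnerCorner (σ⁻ y) → ¬ ¬ Is0or1 (jump (ℓ (σ⁻ y)) (ℓ y))
  vertexStep y innerY innerσ⁻y = ¬¬-map byVertexKind ¬¬-excluded-middle
    where
    byVertexKind : Dec (∃ λ i → AtOuterVertex i (σ⁻ y)) → Is0or1 (jump (ℓ (σ⁻ y)) (ℓ y))
    byVertexKind (yes (i , k , σᵏoutᵢ≡σ⁻y))
      rewrite L0 i (σ⁻ y) (k , σᵏoutᵢ≡σ⁻y) innerσ⁻y
            | L0 i y (suc k , trans (cong σ σᵏoutᵢ≡σ⁻y) (σσ⁻ y)) innerY = inj₁ (jump-refl i)
    byVertexKind (no notOuter) = innerVertexStep y (λ i atVᵢ → notOuter (i , atVᵢ))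

lemma5 : (G : FiveTriangulation) (ℓ : CornerLabeling G) → Is5cLabeling G ℓ →
         ∀ x → FiveTriangulation.InnerEdge G x → edgeJumpSum G ℓ x ≡ 5
lemma5 G ℓ L x inner = decidable-stable (edgeJumpSum G ℓ x ≟ 5) do
    jumpAtα ← vertexStep (α x) (innerEdge⇒innerCorner innerα) (innerEdge⇒innerCorner-σ⁻ innerα)
    jumpAtx ← vertexStep x (innerEdge⇒innerCorner inner) (innerEdge⇒innerCorner-σ⁻ inner)
    pure (jumpCycleSum≡5 (ℓ x) (ℓ (σ⁻ (α x))) (ℓ (α x)) (ℓ (σ⁻ x))
      (faceStep x (innerEdge⇒innerCorner inner))
      jumpAtα
      (subst (λ z → Is1or2 (jump (ℓ (α x)) (ℓ z))) (faceCW-α x) (faceStep (α x) (innerEdge⇒innerCorner innerα)))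
      jumpAtx)
  where
  open FiveTriangulation G
  open InnerEdges G
  open LabeledTriangulation G ℓ L
  open RawMonad (¬¬-Monad {a = 0ℓ})
  innerα : InnerEdge (α x)
  innerα = innerEdge-α inner
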